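{- Let $\lambda=(\lambda_1,\ldots,\lambda_n)$ and $\rho=(\rho_1,\ldots,\rho_n)$ be partitions with $\lambda_i\le\rho_i$ for each $i$ and $\lambda_i<\rho_i$ for at least one $i$. Assume all $\lambda_i$ and $\rho_i$ are nonzero and that the number of variables is $N=n+1$. Then there is a bijection $\psi\colon\boldsymbol{S}_{(0,1)}\to\boldsymbol{S}_{(1,0)}$ such that $\boldsymbol{x}_{N-1}^{(S,T)}=\boldsymbol{x}_{N-1}^{\psi(S,T)}$ for all $(S,T)\in\boldsymbol{S}_{(0,1)}$; consequently $\boldsymbol{P}(1,0)+\boldsymbol{P}(0,1)=0$.
   Context: Variables $\boldsymbol{x}=(x_1,\ldots,x_N)$, $\boldsymbol{x}_{N-1}=(x_1,\ldots,x_{N-1})$. A skew SSYT is a filling of a skew shape with positive integers with rows weakly increasing and columns strictly increasing. For an integer $d$, $\rho/d$ is the skew shape obtained from the Young diagram of $\rho$ by removing the first $d$ boxes of the first row. For $0\le d\le\rho_1$, $0\le e\le\lambda_1$, $\boldsymbol{S}_{(d,e)}$ is the set of pairs $(S,T)$ with $S$ a skew SSYT of shape $\rho/d$ and $T$ a skew SSYT of shape $\lambda/e$, both with entries in $\{1,\ldots,N-1\}$, and $\boldsymbol{x}_{N-1}^{(S,T)}=\boldsymbol{x}_{N-1}^S\boldsymbol{x}_{N-1}^T$, where $\boldsymbol{x}_{N-1}^S=\prod_{\text{boxes}}x_{S_{i,j}}$. Further $\boldsymbol{P}(d,e)=(e-d)\,x_N^{d+e-1}\,s_{\rho/d}(\boldsymbol{x}_{N-1})\,s_{\lambda/e}(\boldsymbol{x}_{N-1})$,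 where $s_{\rho/d}(\boldsymbol{x}_{N-1})=\sum\boldsymbol{x}_{N-1}^S$ over skew SSYT's $S$ of shape $\rho/d$ with entries in $\{1,\ldots,N-1\}$. -}

module Defs where

open import Data.Nat using (ℕ; zero; suc; _+_; _≤_; _<_; _≤ᵇ_)
open import Data.Bool using (Bool; true; false; if_then_else_; _∧_)
open import Data.Fin using (Fin; _≟_)
import Data.Fin as F
open import Data.Vec using (Vec; []; _∷_; lookup)
open import Data.Product using (Σ; _×_; ∃)
open import Relation.Nullary.Decidable using (⌊_⌋)
open import Relation.Binary.PropositionalEquality using (_≡_)

-- A partition with (at most) n parts is stored as a Vec ℕ n.
-- Rows are indexed by ℕ (row 0 = first row); rows beyond n have length 0.
rowLen : ∀ {n} → Vec ℕ n → ℕ → ℕ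
rowLen []       _       = 0
rowLen (x ∷ xs) zero    = x
rowLen (x ∷ xs) (suc i) = rowLen xs i

IsPartition : ∀ {n} → Vec ℕ n → Set
IsPartition μ = ∀ i → rowLen μ (suc i) ≤ rowLen μ i

AllPositive : ∀ {n} → Vec ℕ n → Set
AllPositive {n} μ = (i : Fin n) → 0 < lookup μ i

-- (i , j) (row, column, 0-indexed) is a box of the skew shape μ/d,
-- i.e. of μ with the first d boxes of the first row removed.
InSkew : ∀ {n} → Vec ℕ n → ℕ → ℕ → ℕ → Set
InSkew μ d i j = j < rowLen μ i × (i ≡ 0 → d ≤ j)

-- Skew semistandard tableau of shape μ/d with entries in Fin n
-- (Fin n value k stands for the entry k+1, so entries are {1,…,n} = {1,…,N-1}).
-- The filling is a function on all positions; only its values on boxes matter.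
record SkewSSYT (n : ℕ) (μ : Vec ℕ n) (d : ℕ) : Set where
  field
    fill      : ℕ → ℕ → Fin n
    rowWeak   : ∀ i j → InSkew μ d i j → InSkew μ d i (suc j) →
                fill i j F.≤ fill i (suc j)
    colStrict : ∀ i j → InSkew μ d i j → InSkew μ d (suc i) j →
                fill i j F.< fill (suc i) j
open SkewSSYT public

_≈T_ : ∀ {n μ d} → SkewSSYT n μ d → SkewSSYT n μ d → Set
_≈T_ {n} {μ} {d} S S' = ∀ i j → InSkew μ d i j → fill S i j ≡ fill S' i j

Pairs : (n : ℕ) → Vec ℕ n → Vec ℕ n → ℕ → ℕ → Set
Pairs n ρ lam d e = SkewSSYT n ρ d × SkewSSYT n lam e

_≈P_ : ∀ {n ρ lam d e} → Pairs n ρ lam d e → Pairs n ρ lam d e → Set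
(S Data.Product., T) ≈P (S' Data.Product., T') = (S ≈T S') × (T ≈T T')

sumTo : ℕ → (ℕ → ℕ) → ℕ
sumTo zero    f = 0
sumTo (suc m) f = sumTo m f + f m

skewOK : ℕ → ℕ → ℕ → Bool
skewOK d zero    j = d ≤ᵇ j
skewOK d (suc i) j = true

content : ∀ {n} (μ : Vec ℕ n) (d : ℕ) → SkewSSYT n μ d → Fin n → ℕ
content {n} μ d S k =
  sumTo n (λ i → sumTo (rowLen μ i) (λ j →
    if skewOK d i j ∧ ⌊ fill S i j ≟ k ⌋ then 1 else 0))

-- exponent vector of the monomial x_{N-1}^{(S,T)} = x^S x^T
weight : ∀ {n ρ lam d e} → Pairs n ρ lam d e → Fin n → ℕ
weight {n} {ρ} {lam} {d} {e} (S Data.Product., T) k = content ρ d S k + content lam e T k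

{-# OPTIONS --safe #-}
-- When every row of μ has a box and the entries lie in {1,…,n}, the first
-- column of a tableau of shape μ/d (d ≤ 1) is squeezed: its entry in row i is
-- at most i, while every entry of row i to the right of the first column is at
-- least i.  Hence the first columns of S and T can be exchanged without
-- breaking any row or column condition, and the exchange only moves boxes
-- between S and T, so the weight is unchanged.
module Submission where

open import Defs
open import Data.Nat using (ℕ; zero; suc; pred; _+_; _∸_; _≤_; _<_; z≤n; s≤s)
open import Data.Nat.Properties
  using (+-comm; +-assoc; +-suc; +-commutativeSemigroup; ≤-refl; ≤-reflexive; ≤-trans; ≤-pred;
         <-trans; ≤-<-trans; <-≤-trans; n<1+n; m<n⇒m<1+n; m≤n+m; m∸n+n≡m)
open import Data.Nat.Tactic.RingSolver using (solve-∀)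
open import Algebra.Properties.CommutativeSemigroup +-commutativeSemigroup using (interchange)
open import Data.Fin as F using (Fin; toℕ; _≟_)
open import Data.Fin.Properties using (toℕ<n)
open import Data.Vec using (Vec; _∷_; lookup)
open import Data.Product using (Σ; _×_; ∃; _,_; proj₁; proj₂)
open import Data.Bool using (true; if_then_else_; _∧_)
open import Relation.Nullary.Decidable using (⌊_⌋)
open import Relation.Binary.PropositionalEquality
  using (_≡_; refl; sym; trans; cong; cong₂; module ≡-Reasoning)

sumTo-cong : ∀ m {f g : ℕ → ℕ} → (∀ i → i < m → f i ≡ g i) → sumTo m f ≡ sumTo m g
sumTo-cong zero    f≗g = refl
sumTo-cong (suc m) f≗g =
  cong₂ _+_ (sumTo-cong m (λ i i<m → f≗g i (m<n⇒m<1+n i<m))) (f≗g m (n<1+n m))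

sumTo-distrib : ∀ m (f g : ℕ → ℕ) →
  sumTo m (λ i → f i + g i) ≡ sumTo m f + sumTo m g
sumTo-distrib zero    f g = refl
sumTo-distrib (suc m) f g = trans
  (cong (_+ (f m + g m)) (sumTo-distrib m f g))
  (interchange (sumTo m f) (sumTo m g) (f m) (g m))

sumTo-suc : ∀ m (f : ℕ → ℕ) → sumTo (suc m) f ≡ f 0 + sumTo m (λ j → f (suc j))
sumTo-suc zero    f = +-comm 0 (f 0)
sumTo-suc (suc m) f = trans (cong (_+ f (suc m)) (sumTo-suc m f)) (+-assoc (f 0) _ _)

sumTo-head : ∀ {m} (f : ℕ → ℕ) → 0 < m → sumTo m f ≡ f 0 + sumTo (pred m) (λ j → f (suc j))
sumTo-head {suc m} f _ = sumTo-suc m f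

rowLen>0 : ∀ {n} (μ : Vec ℕ n) → AllPositive μ → ∀ {i} → i < n → 0 < rowLen μ i
rowLen>0 (x ∷ μ) μ>0 {zero}  _         = μ>0 F.zero
rowLen>0 (x ∷ μ) μ>0 {suc i} (s≤s i<n) = rowLen>0 μ (λ k → μ>0 (F.suc k)) i<n

rowLen>0⇒<n : ∀ {n} (μ : Vec ℕ n) {i} → 0 < rowLen μ i → i < n
rowLen>0⇒<n (x ∷ μ) {zero}  _   = s≤s z≤n
rowLen>0⇒<n (x ∷ μ) {suc i} len = s≤s (rowLen>0⇒<n μ len)

inSkew-firstColumn : ∀ {n} (μ ν : Vec ℕ n) {e i} →
  AllPositive ν → InSkew μ e i 0 → InSkew ν e i 0
inSkew-firstColumn μ ν ν>0 (len , top) = rowLen>0 ν ν>0 (rowLen>0⇒<n μ len) , top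

inSkew-laterColumn : ∀ {n} (μ : Vec ℕ n) {d e i j} →
  e ≤ 1 → InSkew μ d i (suc j) → InSkew μ e i (suc j)
inSkew-laterColumn μ e≤1 (len , _) = len , λ _ → ≤-trans e≤1 (s≤s z≤n)

skewOK-laterColumn : ∀ {d} → d ≤ 1 → ∀ i j → skewOK d i (suc j) ≡ true
skewOK-laterColumn z≤n       zero    j = refl
skewOK-laterColumn (s≤s z≤n) zero    j = refl
skewOK-laterColumn _         (suc i) j = refl

row≤entry : ∀ {n μ d} (X : SkewSSYT n μ d) → IsPartition μ →
  ∀ i {j} → d ≤ j → j < rowLen μ i → i ≤ toℕ (fill X i j)
row≤entry X μ-part zero    d≤j len = z≤n
row≤entry {μ = μ} X μ-part (suc i) {j} d≤j len =
  ≤-<-trans (row≤entry X μ-part i d≤j len′)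
            (colStrict X i j (len′ , λ _ → d≤j) (len , λ ()))
  where
  len′ : j < rowLen μ i
  len′ = <-≤-trans len (μ-part i)

firstColumnEntry≤row : ∀ {n μ d} (X : SkewSSYT n μ d) → AllPositive μ →
  ∀ {i} → InSkew μ d i 0 → toℕ (fill X i 0) ≤ i
firstColumnEntry≤row {n} {μ} {d} X μ>0 {i} (len , top) =
  fromLastRow (n ∸ suc i) i top (sym (m∸n+n≡m (rowLen>0⇒<n μ len)))
  where
  -- m counts the rows below row i; the entry of the last row is below n.
  fromLastRow : ∀ m i → (i ≡ 0 → d ≤ 0) → n ≡ m + suc i → toℕ (fill X i 0) ≤ i
  fromLastRow zero    i top n≡1+i = ≤-pred (<-≤-trans (toℕ<n (fill X i 0)) (≤-reflexive n≡1+i))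
  fromLastRow (suc m) i top n≡m+2+i =
    ≤-pred (<-≤-trans (colStrict X i 0 (rowLen>0 μ μ>0 i<n , top) (rowLen>0 μ μ>0 1+i<n , λ ()))
                      (fromLastRow m (suc i) (λ ()) (trans n≡m+2+i (sym (+-suc m (suc i))))))
    where
    1+i<n : suc i < n
    1+i<n = ≤-trans (s≤s (m≤n+m (suc i) m)) (≤-reflexive (sym n≡m+2+i))
    i<n : i < n
    i<n = <-trans (n<1+n i) 1+i<n

withFirstColumnOf : ∀ {n} → (ℕ → ℕ → Fin n) → (ℕ → ℕ → Fin n) → ℕ → ℕ → Fin n
withFirstColumnOf f g i zero    = g i zero
withFirstColumnOf f g i (suc j) = f i (suc j)

withFirstColumnOf-swap-swap : ∀ {n} (f g : ℕ → ℕ → Fin n) i j →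
  withFirstColumnOf (withFirstColumnOf f g) (withFirstColumnOf g f) i j ≡ f i j
withFirstColumnOf-swap-swap f g i zero    = refl
withFirstColumnOf-swap-swap f g i (suc j) = refl

module _ {n} (μ ν : Vec ℕ n) (μ-part : IsPartition μ) (ν>0 : AllPositive ν)
         {d} (d≤1 : d ≤ 1) where

  graftFirstColumn : ∀ {e} → SkewSSYT n μ d → SkewSSYT n ν e → SkewSSYT n μ e
  fill (graftFirstColumn X Y) = withFirstColumnOf (fill X) (fill Y)
  rowWeak (graftFirstColumn X Y) i zero box box′ =
    ≤-trans (firstColumnEntry≤row Y ν>0 (inSkew-firstColumn μ ν ν>0 box))
            (row≤entry X μ-part i d≤1 (proj₁ box′))
  rowWeak (graftFirstColumn X Y) i (suc j) box box′ =
    rowWeak X i (suc j) (inSkew-laterColumn μ d≤1 box) (inSkew-laterColumn μ d≤1 box′)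
  colStrict (graftFirstColumn X Y) i zero box box′ =
    colStrict Y i 0 (inSkew-firstColumn μ ν ν>0 box) (inSkew-firstColumn μ ν ν>0 box′)
  colStrict (graftFirstColumn X Y) i (suc j) box box′ =
    colStrict X i (suc j) (inSkew-laterColumn μ d≤1 box) (inSkew-laterColumn μ d≤1 box′)

  graftFirstColumn-cong : ∀ {e} (X X′ : SkewSSYT n μ d) (Y Y′ : SkewSSYT n ν e) →
    X ≈T X′ → Y ≈T Y′ → graftFirstColumn X Y ≈T graftFirstColumn X′ Y′
  graftFirstColumn-cong _ _ _ _ X≈X′ Y≈Y′ i zero    box = Y≈Y′ i 0 (inSkew-firstColumn μ ν ν>0 box)
  graftFirstColumn-cong _ _ _ _ X≈X′ Y≈Y′ i (suc j) box = X≈X′ i (suc j) (inSkew-laterColumn μ d≤1 box)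

firstColumnCount : ∀ {n} → ℕ → (ℕ → ℕ → Fin n) → Fin n → ℕ
firstColumnCount {n} d f k = sumTo n (λ i → if skewOK d i 0 ∧ ⌊ f i 0 ≟ k ⌋ then 1 else 0)

laterColumnsCount : ∀ {n} → Vec ℕ n → (ℕ → ℕ → Fin n) → Fin n → ℕ
laterColumnsCount {n} μ f k =
  sumTo n (λ i → sumTo (pred (rowLen μ i)) (λ j → if ⌊ f i (suc j) ≟ k ⌋ then 1 else 0))

content-split : ∀ {n} (μ : Vec ℕ n) → AllPositive μ →
  ∀ {d} → d ≤ 1 → (X : SkewSSYT n μ d) → ∀ k →
  content μ d X k ≡ firstColumnCount d (fill X) k + laterColumnsCount μ (fill X) k
content-split {n} μ μ>0 {d} d≤1 X k =
  trans (sumTo-cong n splitRow) (sumTo-distrib n _ _)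
  where
  count : ℕ → ℕ → ℕ
  count i j = if skewOK d i j ∧ ⌊ fill X i j ≟ k ⌋ then 1 else 0
  splitRow : ∀ i → i < n → sumTo (rowLen μ i) (count i) ≡
    count i 0 + sumTo (pred (rowLen μ i)) (λ j → if ⌊ fill X i (suc j) ≟ k ⌋ then 1 else 0)
  splitRow i i<n = trans (sumTo-head (count i) (rowLen>0 μ μ>0 i<n))
    (cong (count i 0 +_) (sumTo-cong (pred (rowLen μ i)) λ j _ →
      cong (λ ok → if ok ∧ ⌊ fill X i (suc j) ≟ k ⌋ then 1 else 0) (skewOK-laterColumn d≤1 i j)))

module FirstColumnSwap {n} (ρ λ' : Vec ℕ n) (ρ-part : IsPartition ρ) (λ-part : IsPartition λ')
                      (ρ>0 : AllPositive ρ) (λ>0 : AllPositive λ') where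

  swapFirstColumns : ∀ {d e} → d ≤ 1 → e ≤ 1 → Pairs n ρ λ' d e → Pairs n ρ λ' e d
  swapFirstColumns d≤1 e≤1 (S , T) =
    graftFirstColumn ρ λ' ρ-part λ>0 d≤1 S T , graftFirstColumn λ' ρ λ-part ρ>0 e≤1 T S

  module _ {d e} (d≤1 : d ≤ 1) (e≤1 : e ≤ 1) where

    swapFirstColumns-cong : ∀ a a′ → a ≈P a′ →
      swapFirstColumns d≤1 e≤1 a ≈P swapFirstColumns d≤1 e≤1 a′
    swapFirstColumns-cong (S , T) (S′ , T′) (S≈S′ , T≈T′) =
      graftFirstColumn-cong ρ λ' ρ-part λ>0 d≤1 S S′ T T′ S≈S′ T≈T′ ,
      graftFirstColumn-cong λ' ρ λ-part ρ>0 e≤1 T T′ S S′ T≈T′ S≈S′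

    swapFirstColumns-involutive : ∀ a →
      swapFirstColumns e≤1 d≤1 (swapFirstColumns d≤1 e≤1 a) ≈P a
    swapFirstColumns-involutive (S , T) =
      (λ i j _ → withFirstColumnOf-swap-swap (fill S) (fill T) i j) ,
      (λ i j _ → withFirstColumnOf-swap-swap (fill T) (fill S) i j)

    swapFirstColumns-weight : ∀ a k → weight (swapFirstColumns d≤1 e≤1 a) k ≡ weight a k
    swapFirstColumns-weight (S , T) k = begin
      weight swapped k
        ≡⟨ cong₂ _+_ (content-split ρ ρ>0 e≤1 (proj₁ swapped) k)
                     (content-split λ' λ>0 d≤1 (proj₂ swapped) k) ⟩
      (firstColumnCount e (fill T) k + laterColumnsCount ρ (fill S) k) +
      (firstColumnCount d (fill S) k + laterColumnsCount λ' (fill T) k)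
        ≡⟨ exchange (firstColumnCount e (fill T) k) (laterColumnsCount ρ (fill S) k)
                    (firstColumnCount d (fill S) k) (laterColumnsCount λ' (fill T) k) ⟩
      (firstColumnCount d (fill S) k + laterColumnsCount ρ (fill S) k) +
      (firstColumnCount e (fill T) k + laterColumnsCount λ' (fill T) k)
        ≡⟨ sym (cong₂ _+_ (content-split ρ ρ>0 d≤1 S k) (content-split λ' λ>0 e≤1 T k)) ⟩
      weight (S , T) k ∎
      where
      open ≡-Reasoning
      swapped : Pairs n ρ λ' e d
      swapped = swapFirstColumns d≤1 e≤1 (S , T)
      exchange : ∀ a x b y → (a + x) + (b + y) ≡ (b + x) + (a + y)
      exchange = solve-∀

lemma2p4 : (n : ℕ) (λ' ρ : Vec ℕ n) →
    IsPartition λ' → IsPartition ρ → AllPositive λ' → AllPositive ρ →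
    ((i : Fin n) → lookup λ' i ≤ lookup ρ i) →
    ∃ (λ (i : Fin n) → lookup λ' i < lookup ρ i) →
    Σ (Pairs n ρ λ' 0 1 → Pairs n ρ λ' 1 0) (λ ψ →
    Σ (Pairs n ρ λ' 1 0 → Pairs n ρ λ' 0 1) (λ φ →
      (∀ a a' → a ≈P a' → ψ a ≈P ψ a') ×
      (∀ b b' → b ≈P b' → φ b ≈P φ b') ×
      (∀ a → φ (ψ a) ≈P a) ×
      (∀ b → ψ (φ b) ≈P b) ×
      (∀ a (k : Fin n) → weight (ψ a) k ≡ weight a k)))
lemma2p4 n λ' ρ λ-part ρ-part λ>0 ρ>0 _ _ =
  swapFirstColumns 0≤1 1≤1 , swapFirstColumns 1≤1 0≤1 ,
  swapFirstColumns-cong 0≤1 1≤1 , swapFirstColumns-cong 1≤1 0≤1 ,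
  swapFirstColumns-involutive 0≤1 1≤1 , swapFirstColumns-involutive 1≤1 0≤1 ,
  swapFirstColumns-weight 0≤1 1≤1
  where
  open FirstColumnSwap ρ λ' ρ-part λ-part ρ>0 λ>0
  0≤1 : 0 ≤ 1
  0≤1 = z≤n
  1≤1 : 1 ≤ 1
  1≤1 = ≤-refl
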